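{- $T_\triangleright+I\mathrm{Open}(L_\triangleright)\nvdash\forall x\,\exists y\,x\triangleright y$.
   Context: $L_\triangleright$ is the one-sorted first-order language with function symbols $0$ (constant), $s$, $p$ (unary), $+$ (binary, infix) and a binary predicate symbol $\triangleright$ (infix). $T_\triangleright$ is the theory with axioms (A1) $\forall x\, sx\neq 0$; (A2) $p0=0$; (A3) $\forall x\, p\,sx=x$; (A4) $\forall x\, x+0=x$; (A5) $\forall x\forall y\, x+sy=s(x+y)$; (A6) $0\triangleright 0$; (A7) $\forall x\forall y\,(x\triangleright y\to sx\triangleright (sx+y))$; (A8) $\forall x\forall y\,(sx\triangleright(sx+y)\to x\triangleright y)$; (A9) $\forall x\forall y\forall z\,(x\triangleright y\wedge x\triangleright z\to y=z)$. For a formula $\psi(x,\vec z)$, $I_x\psi:=\forall\vec z\,(\psi(0,\vec z)\to\forall x(\psi(x,\vec z)\to\psi(sx,\vec z))\to\forall x\,\psi(x,\vec z))$, and $I\mathrm{Open}(L_\triangleright)$ is the set of all $I_x\psi$ with $\psi$ a quantifier-free $L_\triangleright$ formula. -}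

module Defs where

open import Data.Nat using (ℕ; zero; suc)
open import Data.Fin using (Fin; zero; suc)
open import Data.List using (List; []; _∷_; map)
open import Data.List.Membership.Propositional using (_∈_)

-- Syntax of the one-sorted first-order language L▷, well-scoped
-- (de Bruijn indices; Term n / Formula n have n free variables in scope).

infixl 6 _⊕_
data Term (n : ℕ) : Set where
  var : Fin n → Term n
  zer : Term n
  S   : Term n → Term n
  P   : Term n → Term n
  _⊕_ : Term n → Term n → Term n

infix 4 _≐_ _▷_
infixr 2 _⇒_
data Formula (n : ℕ) : Set where
  ⊥'  : Formula n
  _≐_ : Term n → Term n → Formula n
  _▷_ : Term n → Term n → Formula n
  _⇒_ : Formula n → Formula n → Formula n
  ∀'  : Formula (suc n) → Formula n

¬' : ∀ {n} → Formula n → Formula n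
¬' φ = φ ⇒ ⊥'

infixr 3 _∧'_
_∧'_ : ∀ {n} → Formula n → Formula n → Formula n
φ ∧' ψ = ¬' (φ ⇒ ¬' ψ)

∃' : ∀ {n} → Formula (suc n) → Formula n
∃' φ = ¬' (∀' (¬' φ))

ext : ∀ {n m} → (Fin n → Fin m) → Fin (suc n) → Fin (suc m)
ext ρ zero = zero
ext ρ (suc i) = suc (ρ i)

renT : ∀ {n m} → (Fin n → Fin m) → Term n → Term m
renT ρ (var i) = var (ρ i)
renT ρ zer = zer
renT ρ (S t) = S (renT ρ t)
renT ρ (P t) = P (renT ρ t)
renT ρ (t ⊕ u) = renT ρ t ⊕ renT ρ u

renF : ∀ {n m} → (Fin n → Fin m) → Formula n → Formula m
renF ρ ⊥' = ⊥'
renF ρ (t ≐ u) = renT ρ t ≐ renT ρ u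
renF ρ (t ▷ u) = renT ρ t ▷ renT ρ u
renF ρ (φ ⇒ ψ) = renF ρ φ ⇒ renF ρ ψ
renF ρ (∀' φ) = ∀' (renF (ext ρ) φ)

exts : ∀ {n m} → (Fin n → Term m) → Fin (suc n) → Term (suc m)
exts σ zero = var zero
exts σ (suc i) = renT suc (σ i)

subT : ∀ {n m} → (Fin n → Term m) → Term n → Term m
subT σ (var i) = σ i
subT σ zer = zer
subT σ (S t) = S (subT σ t)
subT σ (P t) = P (subT σ t)
subT σ (t ⊕ u) = subT σ t ⊕ subT σ u

subF : ∀ {n m} → (Fin n → Term m) → Formula n → Formula m
subF σ ⊥' = ⊥'
subF σ (t ≐ u) = subT σ t ≐ subT σ u
subF σ (t ▷ u) = subT σ t ▷ subT σ u
subF σ (φ ⇒ ψ) = subF σ φ ⇒ subF σ ψ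
subF σ (∀' φ) = ∀' (subF (exts σ) φ)

inst : ∀ {n} → Formula (suc n) → Term n → Formula n
inst φ t = subF σ φ
  where
  σ : _ → _
  σ zero = t
  σ (suc i) = var i

fin0 : ∀ {n} → Fin 0 → Fin n
fin0 ()

wkS : ∀ {n} → Formula 0 → Formula n
wkS = renF fin0

data QF {n : ℕ} : Formula n → Set where
  qf⊥ : QF ⊥'
  qf≐ : ∀ {t u} → QF (t ≐ u)
  qf▷ : ∀ {t u} → QF (t ▷ u)
  qf⇒ : ∀ {φ ψ} → QF φ → QF ψ → QF (φ ⇒ ψ)

close : ∀ {k} → Formula k → Formula 0
close {zero} φ = φ
close {suc k} φ = close {k} (∀' φ)

-- I_x ψ for ψ(x, z⃗) with x = variable 0 and z⃗ the remaining k variables: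
-- ∀z⃗ (ψ(0,z⃗) → ∀x(ψ(x,z⃗) → ψ(sx,z⃗)) → ∀x ψ(x,z⃗))
succX : ∀ {k} → Fin (suc k) → Term (suc k)
succX zero = S (var zero)
succX (suc i) = var (suc i)

Ind : ∀ {k} → Formula (suc k) → Formula 0
Ind ψ = close (inst ψ zer ⇒ ∀' (ψ ⇒ subF succX ψ) ⇒ ∀' ψ)

private
  v0 : ∀ {n} → Term (suc n)
  v0 = var zero
  v1 : ∀ {n} → Term (suc (suc n))
  v1 = var (suc zero)
  v2 : ∀ {n} → Term (suc (suc (suc n)))
  v2 = var (suc (suc zero))

data T▷+IOpen : Formula 0 → Set where
  A1 : T▷+IOpen (∀' (¬' (S v0 ≐ zer)))
  A2 : T▷+IOpen (P zer ≐ zer)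
  A3 : T▷+IOpen (∀' (P (S v0) ≐ v0))
  A4 : T▷+IOpen (∀' (v0 ⊕ zer ≐ v0))
  A5 : T▷+IOpen (∀' (∀' (v1 ⊕ S v0 ≐ S (v1 ⊕ v0))))
  A6 : T▷+IOpen (zer ▷ zer)
  A7 : T▷+IOpen (∀' (∀' (v1 ▷ v0 ⇒ S v1 ▷ (S v1 ⊕ v0))))
  A8 : T▷+IOpen (∀' (∀' (S v1 ▷ (S v1 ⊕ v0) ⇒ v1 ▷ v0)))
  A9 : T▷+IOpen (∀' (∀' (∀' (v2 ▷ v1 ∧' v2 ▷ v0 ⇒ v1 ≐ v0))))
  IOpen : ∀ {k} (ψ : Formula (suc k)) → QF ψ → T▷+IOpen (Ind ψ)

infix 1 _∣_⊢_
data _∣_⊢_ (T : Formula 0 → Set) {n : ℕ} (Γ : List (Formula n)) : Formula n → Set where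
  hyp  : ∀ {φ} → φ ∈ Γ → T ∣ Γ ⊢ φ
  ax   : ∀ {ψ} → T ψ → T ∣ Γ ⊢ wkS ψ
  ⇒I   : ∀ {φ ψ} → T ∣ φ ∷ Γ ⊢ ψ → T ∣ Γ ⊢ φ ⇒ ψ
  ⇒E   : ∀ {φ ψ} → T ∣ Γ ⊢ φ ⇒ ψ → T ∣ Γ ⊢ φ → T ∣ Γ ⊢ ψ
  raa  : ∀ {φ} → T ∣ ¬' φ ∷ Γ ⊢ ⊥' → T ∣ Γ ⊢ φ
  ∀I   : ∀ {φ} → T ∣ map (renF suc) Γ ⊢ φ → T ∣ Γ ⊢ ∀' φ
  ∀E   : ∀ {φ} → T ∣ Γ ⊢ ∀' φ → (t : Term n) → T ∣ Γ ⊢ inst φ t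
  ≐refl : ∀ {t} → T ∣ Γ ⊢ t ≐ t
  ≐E   : ∀ {t u} (φ : Formula (suc n)) → T ∣ Γ ⊢ t ≐ u → T ∣ Γ ⊢ inst φ t → T ∣ Γ ⊢ inst φ u

_⊢_ : (Formula 0 → Set) → Formula 0 → Set
T ⊢ σ = T ∣ [] ⊢ σ

module Submission where

-- We build a model of T▷ + IOpen in which ω has no ▷-successor. Besides ℕ it contains the
-- elements (a + 1)·ω + z for a ∈ ℕ, z ∈ ℤ, with the evident s, p and +; x ▷ y holds only for
-- standard x with y = x(x + 1)/2, so A6–A9 hold. For open induction, every term t(x, z⃗) agrees
-- with an affine function m·x + c (m ∈ ℕ, c ∈ model) once the finite part of x is large in
-- absolute value. Hence every open formula has an eventually constant truth value: affine
-- functions eventually agree only if their coefficients do, and ▷ between them is eventually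
-- false unless both are constant, since triangular numbers outgrow linear functions. An open
-- formula closed under s and true at 0 holds on ℕ, hence at large standard elements, hence far
-- out in every nonstandard copy of ℤ, from where successor steps reach every element.

open import Defs
import Data.Integer.Properties as ℤₚ
open import Algebra.Properties.AbelianGroup ℤₚ.+-0-abelianGroup using () renaming (∙-cancelˡ to +-cancelˡ-ℤ)
open import Data.Empty using (⊥; ⊥-elim)
open import Data.Fin using (Fin; zero; suc)
open import Data.Integer as ℤ using (ℤ; +_; -[1+_]; 0ℤ; 1ℤ; ∣_∣; +≤+)
open import Data.Integer.Tactic.RingSolver using (solve-∀)
open import Data.List using (List)
open import Data.List.Relation.Unary.All as All using (All; []; _∷_)
import Data.List.Relation.Unary.All.Properties as All
open import Data.Nat as ℕ using (ℕ; zero; suc; z≤n; _⊔_)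
import Data.Nat.Properties as ℕₚ
import Data.Nat.Tactic.RingSolver as ℕ-Solver
open import Data.Product using (Σ; ∃; _×_; _,_; proj₂; uncurry)
open import Function using (_∘_; id)
open import Function.Bundles using (_⇔_; mk⇔; Equivalence)
open import Function.Construct.Composition using (_⇔-∘_)
open import Function.Construct.Identity using (⇔-id)
open import Function.Related.TypeIsomorphisms using (→-cong-⇔; ¬-cong-⇔)
open import Relation.Binary.PropositionalEquality
open import Relation.Nullary using (¬_; yes; no)
open import Relation.Nullary.Negation using (¬¬-map; negated-stable)

open Equivalence using (to; from)

private
  variable
    k n m : ℕ

-- Semantics and soundness

Π-cong-⇔ : ∀ {A : Set} {B C : A → Set} → (∀ a → B a ⇔ C a) → (∀ a → B a) ⇔ (∀ a → C a)
Π-cong-⇔ B⇔C = mk⇔ (λ f a → to (B⇔C a) (f a)) (λ g a → from (B⇔C a) (g a))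

record Structure : Set₁ where
  infixl 6 _+ᴹ_
  infix 4 _▷ᴹ_
  field
    Carrier    : Set
    zeroᴹ      : Carrier
    sucᴹ predᴹ : Carrier → Carrier
    _+ᴹ_       : Carrier → Carrier → Carrier
    _▷ᴹ_       : Carrier → Carrier → Set

module Semantics (𝓜 : Structure) where
  open Structure 𝓜

  Env : ℕ → Set
  Env n = Fin n → Carrier

  ∅ : Env 0
  ∅ ()

  infixr 5 _∷ₑ_
  _∷ₑ_ : Carrier → Env n → Env (suc n)
  (d ∷ₑ ρ) zero = d
  (d ∷ₑ ρ) (suc i) = ρ i

  ⟦_⟧t : Term n → Env n → Carrier
  ⟦ var i ⟧t ρ = ρ i
  ⟦ zer ⟧t ρ = zeroᴹ
  ⟦ S t ⟧t ρ = sucᴹ (⟦ t ⟧t ρ)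
  ⟦ P t ⟧t ρ = predᴹ (⟦ t ⟧t ρ)
  ⟦ t ⊕ u ⟧t ρ = ⟦ t ⟧t ρ +ᴹ ⟦ u ⟧t ρ

  -- Atomic formulas are read through ¬ ¬, which makes every formula ¬¬-stable
  -- and so lets the classical rules raa and ≐E be validated constructively.
  ⟦_⟧ : Formula n → Env n → Set
  ⟦ ⊥' ⟧ ρ = ⊥
  ⟦ t ≐ u ⟧ ρ = ¬ ¬ (⟦ t ⟧t ρ ≡ ⟦ u ⟧t ρ)
  ⟦ t ▷ u ⟧ ρ = ¬ ¬ (⟦ t ⟧t ρ ▷ᴹ ⟦ u ⟧t ρ)
  ⟦ φ ⇒ ψ ⟧ ρ = ⟦ φ ⟧ ρ → ⟦ ψ ⟧ ρ
  ⟦ ∀' φ ⟧ ρ = ∀ d → ⟦ φ ⟧ (d ∷ₑ ρ)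

  ⟦⟧-stable : ∀ (φ : Formula n) ρ → ¬ ¬ ⟦ φ ⟧ ρ → ⟦ φ ⟧ ρ
  ⟦⟧-stable ⊥' ρ ¬¬⊥ = ¬¬⊥ id
  ⟦⟧-stable (t ≐ u) ρ = negated-stable
  ⟦⟧-stable (t ▷ u) ρ = negated-stable
  ⟦⟧-stable (φ ⇒ ψ) ρ ¬¬f a = ⟦⟧-stable ψ ρ (¬¬-map (λ f → f a) ¬¬f)
  ⟦⟧-stable (∀' φ) ρ ¬¬f d = ⟦⟧-stable φ (d ∷ₑ ρ) (¬¬-map (λ f → f d) ¬¬f)

  ¬¬-cong₂ : ∀ (R : Carrier → Carrier → Set) {a a′ b b′} → a ≡ a′ → b ≡ b′ → (¬ ¬ R a b) ⇔ (¬ ¬ R a′ b′)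
  ¬¬-cong₂ R refl refl = ⇔-id _

  ⟦renT⟧ : (r : Fin n → Fin m) {ρ : Env m} {ρ′ : Env n} → (∀ i → ρ (r i) ≡ ρ′ i) →
           ∀ t → ⟦ renT r t ⟧t ρ ≡ ⟦ t ⟧t ρ′
  ⟦renT⟧ r e (var i) = e i
  ⟦renT⟧ r e zer = refl
  ⟦renT⟧ r e (S t) = cong sucᴹ (⟦renT⟧ r e t)
  ⟦renT⟧ r e (P t) = cong predᴹ (⟦renT⟧ r e t)
  ⟦renT⟧ r e (t ⊕ u) = cong₂ _+ᴹ_ (⟦renT⟧ r e t) (⟦renT⟧ r e u)

  ⟦renF⟧ : (r : Fin n → Fin m) {ρ : Env m} {ρ′ : Env n} → (∀ i → ρ (r i) ≡ ρ′ i) →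
           ∀ φ → ⟦ renF r φ ⟧ ρ ⇔ ⟦ φ ⟧ ρ′
  ⟦renF⟧ r e ⊥' = ⇔-id ⊥
  ⟦renF⟧ r e (t ≐ u) = ¬¬-cong₂ _≡_ (⟦renT⟧ r e t) (⟦renT⟧ r e u)
  ⟦renF⟧ r e (t ▷ u) = ¬¬-cong₂ _▷ᴹ_ (⟦renT⟧ r e t) (⟦renT⟧ r e u)
  ⟦renF⟧ r e (φ ⇒ ψ) = →-cong-⇔ (⟦renF⟧ r e φ) (⟦renF⟧ r e ψ)
  ⟦renF⟧ r {ρ} {ρ′} e (∀' φ) = Π-cong-⇔ λ d → ⟦renF⟧ (ext r) (e′ d) φ
    where
    e′ : ∀ d i → (d ∷ₑ ρ) (ext r i) ≡ (d ∷ₑ ρ′) i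
    e′ d zero = refl
    e′ d (suc i) = e i

  ⟦subT⟧ : (σ : Fin n → Term m) {ρ : Env m} {ρ′ : Env n} → (∀ i → ⟦ σ i ⟧t ρ ≡ ρ′ i) →
           ∀ t → ⟦ subT σ t ⟧t ρ ≡ ⟦ t ⟧t ρ′
  ⟦subT⟧ σ e (var i) = e i
  ⟦subT⟧ σ e zer = refl
  ⟦subT⟧ σ e (S t) = cong sucᴹ (⟦subT⟧ σ e t)
  ⟦subT⟧ σ e (P t) = cong predᴹ (⟦subT⟧ σ e t)
  ⟦subT⟧ σ e (t ⊕ u) = cong₂ _+ᴹ_ (⟦subT⟧ σ e t) (⟦subT⟧ σ e u)

  ⟦subF⟧ : (σ : Fin n → Term m) {ρ : Env m} {ρ′ : Env n} → (∀ i → ⟦ σ i ⟧t ρ ≡ ρ′ i) →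
           ∀ φ → ⟦ subF σ φ ⟧ ρ ⇔ ⟦ φ ⟧ ρ′
  ⟦subF⟧ σ e ⊥' = ⇔-id ⊥
  ⟦subF⟧ σ e (t ≐ u) = ¬¬-cong₂ _≡_ (⟦subT⟧ σ e t) (⟦subT⟧ σ e u)
  ⟦subF⟧ σ e (t ▷ u) = ¬¬-cong₂ _▷ᴹ_ (⟦subT⟧ σ e t) (⟦subT⟧ σ e u)
  ⟦subF⟧ σ e (φ ⇒ ψ) = →-cong-⇔ (⟦subF⟧ σ e φ) (⟦subF⟧ σ e ψ)
  ⟦subF⟧ σ {ρ} {ρ′} e (∀' φ) = Π-cong-⇔ λ d → ⟦subF⟧ (exts σ) (e′ d) φ
    where
    e′ : ∀ d i → ⟦ exts σ i ⟧t (d ∷ₑ ρ) ≡ (d ∷ₑ ρ′) i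
    e′ d zero = refl
    e′ d (suc i) = trans (⟦renT⟧ suc (λ _ → refl) (σ i)) (e i)

  ⟦inst⟧ : ∀ (φ : Formula (suc n)) t ρ → ⟦ inst φ t ⟧ ρ ⇔ ⟦ φ ⟧ (⟦ t ⟧t ρ ∷ₑ ρ)
  ⟦inst⟧ φ t ρ = ⟦subF⟧ _ (λ { zero → refl ; (suc i) → refl }) φ

  ⟦succX⟧ : ∀ (φ : Formula (suc n)) d ρ → ⟦ subF succX φ ⟧ (d ∷ₑ ρ) ⇔ ⟦ φ ⟧ (sucᴹ d ∷ₑ ρ)
  ⟦succX⟧ φ d ρ = ⟦subF⟧ succX (λ { zero → refl ; (suc i) → refl }) φ

  ⟦close⟧ : ∀ (φ : Formula n) → (∀ ρ → ⟦ φ ⟧ ρ) → ⟦ close φ ⟧ ∅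
  ⟦close⟧ {zero} φ ⊨φ = ⊨φ ∅
  ⟦close⟧ {suc n} φ ⊨φ = ⟦close⟧ (∀' φ) (λ ρ d → ⊨φ (d ∷ₑ ρ))

  Models : (Formula 0 → Set) → Set
  Models T = ∀ {φ} → T φ → ⟦ φ ⟧ ∅

  soundness : ∀ {T} → Models T → ∀ {Γ : List (Formula n)} {φ} → T ∣ Γ ⊢ φ →
              ∀ ρ → All (λ γ → ⟦ γ ⟧ ρ) Γ → ⟦ φ ⟧ ρ
  soundness ⊨T (hyp φ∈Γ) ρ ⊨Γ = All.lookup ⊨Γ φ∈Γ
  soundness ⊨T (ax {ψ} Tψ) ρ ⊨Γ = from (⟦renF⟧ fin0 (λ ()) ψ) (⊨T Tψ)
  soundness ⊨T (⇒I d) ρ ⊨Γ a = soundness ⊨T d ρ (a ∷ ⊨Γ)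
  soundness ⊨T (⇒E d e) ρ ⊨Γ = soundness ⊨T d ρ ⊨Γ (soundness ⊨T e ρ ⊨Γ)
  soundness ⊨T (raa {φ} d) ρ ⊨Γ = ⟦⟧-stable φ ρ (λ ¬a → soundness ⊨T d ρ (¬a ∷ ⊨Γ))
  soundness ⊨T (∀I d) ρ ⊨Γ a =
    soundness ⊨T d (a ∷ₑ ρ) (All.map⁺ (All.map (λ {γ} → from (⟦renF⟧ suc (λ _ → refl) γ)) ⊨Γ))
  soundness ⊨T (∀E {φ} d t) ρ ⊨Γ = from (⟦inst⟧ φ t ρ) (soundness ⊨T d ρ ⊨Γ (⟦ t ⟧t ρ))
  soundness ⊨T ≐refl ρ ⊨Γ ¬refl = ¬refl refl
  soundness ⊨T (≐E {t} {u} φ d e) ρ ⊨Γ =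
    from (⟦inst⟧ φ u ρ) (⟦⟧-stable φ _ (¬¬-map transport (soundness ⊨T d ρ ⊨Γ)))
    where
    transport : ⟦ t ⟧t ρ ≡ ⟦ u ⟧t ρ → ⟦ φ ⟧ (⟦ u ⟧t ρ ∷ₑ ρ)
    transport t≡u = subst (λ a → ⟦ φ ⟧ (a ∷ₑ ρ)) t≡u (to (⟦inst⟧ φ t ρ) (soundness ⊨T e ρ ⊨Γ))

-- The model

-- nonstd a z stands for (a + 1)·ω + z, for a fixed infinite ω.
data D : Set where
  std    : ℕ → D
  nonstd : ℕ → ℤ → D

sucᴰ : D → D
sucᴰ (std n) = std (suc n)
sucᴰ (nonstd a z) = nonstd a (ℤ.suc z)

predᴰ : D → D
predᴰ (std n) = std (ℕ.pred n)
predᴰ (nonstd a z) = nonstd a (ℤ.pred z)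

infixl 6 _+ᴰ_
_+ᴰ_ : D → D → D
std n +ᴰ std m = std (n ℕ.+ m)
std n +ᴰ nonstd a z = nonstd a (+ n ℤ.+ z)
nonstd a z +ᴰ std m = nonstd a (z ℤ.+ + m)
nonstd a z +ᴰ nonstd b w = nonstd (suc (a ℕ.+ b)) (z ℤ.+ w)

triangle : ℕ → ℕ
triangle zero = 0
triangle (suc n) = suc n ℕ.+ triangle n

infix 4 _▷ᴰ_
_▷ᴰ_ : D → D → Set
std n ▷ᴰ std k = k ≡ triangle n
_ ▷ᴰ _ = ⊥

𝓓 : Structure
𝓓 = record
  { Carrier = D ; zeroᴹ = std 0 ; sucᴹ = sucᴰ ; predᴹ = predᴰ ; _+ᴹ_ = _+ᴰ_ ; _▷ᴹ_ = _▷ᴰ_ }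

open Semantics 𝓓

-- ℤ.suc j unfolds to + 1 ℤ.+ j; the lemma is stated in that form for the ring solver.
+-sucʳ : ∀ i j → i ℤ.+ (+ 1 ℤ.+ j) ≡ + 1 ℤ.+ (i ℤ.+ j)
+-sucʳ = solve-∀

sucᴰ≢std0 : ∀ d → sucᴰ d ≢ std 0
sucᴰ≢std0 (std n) ()
sucᴰ≢std0 (nonstd a z) ()

predᴰ-sucᴰ : ∀ d → predᴰ (sucᴰ d) ≡ d
predᴰ-sucᴰ (std n) = refl
predᴰ-sucᴰ (nonstd a z) = cong (nonstd a) (ℤₚ.pred-suc z)

+ᴰ-identityʳ : ∀ d → d +ᴰ std 0 ≡ d
+ᴰ-identityʳ (std n) = cong std (ℕₚ.+-identityʳ n)
+ᴰ-identityʳ (nonstd a z) = cong (nonstd a) (ℤₚ.+-identityʳ z)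

+ᴰ-suc : ∀ d e → d +ᴰ sucᴰ e ≡ sucᴰ (d +ᴰ e)
+ᴰ-suc (std n) (std m) = cong std (ℕₚ.+-suc n m)
+ᴰ-suc (std n) (nonstd a z) = cong (nonstd a) (+-sucʳ (+ n) z)
+ᴰ-suc (nonstd a z) (std m) = cong (nonstd a) (+-sucʳ z (+ m))
+ᴰ-suc (nonstd a z) (nonstd b w) = cong (nonstd _) (+-sucʳ z w)

▷ᴰ-step : ∀ d e → d ▷ᴰ e → sucᴰ d ▷ᴰ sucᴰ d +ᴰ e
▷ᴰ-step (std n) (std k) k≡Tn = cong (suc n ℕ.+_) k≡Tn

▷ᴰ-unstep : ∀ d e → sucᴰ d ▷ᴰ sucᴰ d +ᴰ e → d ▷ᴰ e
▷ᴰ-unstep (std n) (std k) = ℕₚ.+-cancelˡ-≡ (suc n) k (triangle n)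

▷ᴰ-functional : ∀ d e e′ → d ▷ᴰ e → d ▷ᴰ e′ → e ≡ e′
▷ᴰ-functional (std n) (std k) (std k′) k≡Tn k′≡Tn = cong std (trans k≡Tn (sym k′≡Tn))

-- Eventual behaviour of terms and open formulas

infPart : D → ℕ
infPart (std _) = 0
infPart (nonstd a _) = suc a

finPart : D → ℤ
finPart (std n) = + n
finPart (nonstd _ z) = z

-- fromParts is only meaningful on Canonical arguments: fromParts 0 z takes ∣ z ∣.
fromParts : ℕ → ℤ → D
fromParts zero z = std ∣ z ∣
fromParts (suc a) z = nonstd a z

Canonical : ℕ → ℤ → Set
Canonical a z = a ≡ 0 → 0ℤ ℤ.≤ z

fromParts-parts : ∀ d → fromParts (infPart d) (finPart d) ≡ d
fromParts-parts (std n) = refl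
fromParts-parts (nonstd a z) = refl

canonical-parts : ∀ d → Canonical (infPart d) (finPart d)
canonical-parts (std n) _ = +≤+ z≤n
canonical-parts (nonstd a z) ()

sucᴰ-fromParts : ∀ a z → Canonical a z → sucᴰ (fromParts a z) ≡ fromParts a (ℤ.suc z)
sucᴰ-fromParts zero (+ n) _ = refl
sucᴰ-fromParts zero -[1+ n ] can with can refl
... | ()
sucᴰ-fromParts (suc a) z _ = refl

predᴰ-fromParts : ∀ a z → (a ≡ 0 → 1ℤ ℤ.≤ z) → predᴰ (fromParts a z) ≡ fromParts a (ℤ.pred z)
predᴰ-fromParts zero (+ zero) pos with pos refl
... | +≤+ ()
predᴰ-fromParts zero (+ suc n) _ = refl
predᴰ-fromParts zero -[1+ n ] pos with pos refl
... | ()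
predᴰ-fromParts (suc a) z _ = refl

fromParts-+ᴰ : ∀ a z a′ z′ → Canonical a z → Canonical a′ z′ →
               fromParts a z +ᴰ fromParts a′ z′ ≡ fromParts (a ℕ.+ a′) (z ℤ.+ z′)
fromParts-+ᴰ zero z zero z′ can can′ with can refl | can′ refl
... | +≤+ _ | +≤+ _ = refl
fromParts-+ᴰ zero z (suc a′) z′ can _ with can refl
... | +≤+ _ = refl
fromParts-+ᴰ (suc a) z zero z′ _ can′ with can′ refl
... | +≤+ _ = cong (λ b → nonstd b (z ℤ.+ z′)) (sym (ℕₚ.+-identityʳ a))
fromParts-+ᴰ (suc a) z (suc a′) z′ _ _ = cong (λ b → nonstd b (z ℤ.+ z′)) (sym (ℕₚ.+-suc a a′))

fromParts-injective : ∀ {a z a′ z′} → Canonical a z → Canonical a′ z′ →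
                      fromParts a z ≡ fromParts a′ z′ → a ≡ a′ × z ≡ z′
fromParts-injective {zero} {z} {zero} {z′} can can′ e with can refl | can′ refl
fromParts-injective {zero} {.(+ _)} {zero} {.(+ _)} _ _ refl | +≤+ _ | +≤+ _ = refl , refl
fromParts-injective {zero} {a′ = suc a′} _ _ ()
fromParts-injective {suc a} {a′ = zero} _ _ ()
fromParts-injective {suc a} {a′ = suc a′} _ _ refl = refl , refl

▷ᴰ-fromParts : ∀ {a z a′ z′} → fromParts a z ▷ᴰ fromParts a′ z′ →
               a ≡ 0 × a′ ≡ 0 × ∣ z′ ∣ ≡ triangle ∣ z ∣
▷ᴰ-fromParts {zero} {a′ = zero} r = refl , refl , r
▷ᴰ-fromParts {zero} {a′ = suc a′} ()
▷ᴰ-fromParts {suc a} ()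

-- affine m c b is the function x ↦ m·x + (c·ω + b).
record Affine : Set where
  constructor affine
  field
    slope    : ℕ
    infConst : ℕ
    finConst : ℤ

open Affine using (finConst)

infAt : Affine → D → ℕ
infAt (affine m c _) x = m ℕ.* infPart x ℕ.+ c

finAt : Affine → D → ℤ
finAt (affine m _ b) x = + m ℤ.* finPart x ℤ.+ b

infix 8 _at_
_at_ : Affine → D → D
s at x = fromParts (infAt s x) (finAt s x)

CanonicalAt : Affine → D → Set
CanonicalAt s x = Canonical (infAt s x) (finAt s x)

finAt-slope0 : ∀ c b x → finAt (affine 0 c b) x ≡ b
finAt-slope0 c b x = ℤₚ.+-identityˡ b

at-slope0 : ∀ c b x → affine 0 c b at x ≡ fromParts c b
at-slope0 c b x = cong (fromParts c) (finAt-slope0 c b x)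

at-represents : ∀ s x d → infAt s x ≡ infPart d → finAt s x ≡ finPart d → d ≡ s at x × CanonicalAt s x
at-represents s x d inf≡ fin≡ rewrite inf≡ | fin≡ = sym (fromParts-parts d) , canonical-parts d

idᵃ : Affine
idᵃ = affine 1 0 0ℤ

constᵃ : D → Affine
constᵃ d = affine 0 (infPart d) (finPart d)

sucᵃ : Affine → Affine
sucᵃ (affine m c b) = affine m c (ℤ.suc b)

predᵃ : Affine → Affine
predᵃ (affine zero zero b) = affine 0 0 (+ ℕ.pred ∣ b ∣)
predᵃ (affine zero (suc c) b) = affine 0 (suc c) (ℤ.pred b)
predᵃ (affine (suc m) c b) = affine (suc m) c (ℤ.pred b)

infixl 6 _⊕ᵃ_
_⊕ᵃ_ : Affine → Affine → Affine
affine m c b ⊕ᵃ affine m′ c′ b′ = affine (m ℕ.+ m′) (c ℕ.+ c′) (b ℤ.+ b′)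

idᵃ-at : ∀ x → x ≡ idᵃ at x × CanonicalAt idᵃ x
idᵃ-at x = at-represents idᵃ x x
  (trans (ℕₚ.+-identityʳ _) (ℕₚ.*-identityˡ _)) (trans (ℤₚ.+-identityʳ _) (ℤₚ.*-identityˡ _))

constᵃ-at : ∀ d x → d ≡ constᵃ d at x × CanonicalAt (constᵃ d) x
constᵃ-at d x = at-represents (constᵃ d) x d refl (finAt-slope0 (infPart d) (finPart d) x)

sucᵃ-at : ∀ s x → CanonicalAt s x → sucᴰ (s at x) ≡ sucᵃ s at x × CanonicalAt (sucᵃ s) x
sucᵃ-at (affine m c b) x can =
  trans (sucᴰ-fromParts _ _ can) (cong (fromParts _) (sym fin≡)) ,
  λ inf≡0 → subst (0ℤ ℤ.≤_) (sym fin≡) (ℤₚ.i≤j⇒i≤1+j (can inf≡0))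
  where
  fin≡ : finAt (sucᵃ (affine m c b)) x ≡ ℤ.suc (finAt (affine m c b) x)
  fin≡ = +-sucʳ (+ m ℤ.* finPart x) b

1≤+q+b : ∀ q b → suc ∣ b ∣ ℕ.≤ q → 1ℤ ℤ.≤ + q ℤ.+ b
1≤+q+b q (+ j) big = +≤+ (ℕₚ.≤-trans (ℕₚ.m≤m+n 1 j) (ℕₚ.≤-trans big (ℕₚ.m≤m+n q j)))
1≤+q+b q -[1+ j ] big rewrite ℤₚ.⊖-≥ (ℕₚ.<⇒≤ big) = +≤+ (ℕₚ.m<n⇒0<n∸m big)

positive-at : ∀ m c b x → suc ∣ b ∣ ℕ.≤ ∣ finPart x ∣ →
              infAt (affine (suc m) c b) x ≡ 0 → 1ℤ ℤ.≤ finAt (affine (suc m) c b) x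
positive-at m c b (std n) big _ =
  subst (λ i → 1ℤ ℤ.≤ i ℤ.+ b) (ℤₚ.pos-* (suc m) n) (1≤+q+b _ b (ℕₚ.≤-trans big (ℕₚ.m≤n*m n (suc m))))
positive-at m c b (nonstd a z) _ ()

predᵃ-at : ∀ s x → suc ∣ finConst s ∣ ℕ.≤ ∣ finPart x ∣ → CanonicalAt s x →
           predᴰ (s at x) ≡ predᵃ s at x × CanonicalAt (predᵃ s) x
predᵃ-at (affine zero zero b) x _ _ rewrite ℤₚ.+-identityˡ b | ℤₚ.+-identityˡ (+ ℕ.pred ∣ b ∣) =
  refl , λ _ → +≤+ z≤n
predᵃ-at (affine zero (suc c) b) x _ _ = cong (nonstd c) (sym (ℤₚ.+-pred 0ℤ b)) , λ ()
predᵃ-at (affine (suc m) c b) x big _ =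
  trans (predᴰ-fromParts _ _ pos) (cong (fromParts _) (sym fin≡)) ,
  λ inf≡0 → subst (0ℤ ℤ.≤_) (sym fin≡) (ℤₚ.i<j⇒i≤pred[j] (ℤₚ.suc[i]≤j⇒i<j (pos inf≡0)))
  where
  fin≡ : finAt (predᵃ (affine (suc m) c b)) x ≡ ℤ.pred (finAt (affine (suc m) c b) x)
  fin≡ = ℤₚ.+-pred (+ suc m ℤ.* finPart x) b
  pos : infAt (affine (suc m) c b) x ≡ 0 → 1ℤ ℤ.≤ finAt (affine (suc m) c b) x
  pos = positive-at m c b x big

⊕ᵃ-at : ∀ s t x → CanonicalAt s x → CanonicalAt t x →
        s at x +ᴰ t at x ≡ (s ⊕ᵃ t) at x × CanonicalAt (s ⊕ᵃ t) x
⊕ᵃ-at (affine m c b) (affine m′ c′ b′) x can can′ =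
  trans (fromParts-+ᴰ _ _ _ _ can can′) (cong₂ fromParts (sym inf≡) (sym fin≡)) ,
  λ inf≡0 → let sum≡0 = trans (sym inf≡) inf≡0 in
    subst (0ℤ ℤ.≤_) (sym fin≡)
      (ℤₚ.+-mono-≤ (can (ℕₚ.m+n≡0⇒m≡0 (infAt (affine m c b) x) sum≡0))
                    (can′ (ℕₚ.m+n≡0⇒n≡0 (infAt (affine m c b) x) sum≡0)))
  where
  inf-distrib : ∀ m m′ a c c′ → (m ℕ.+ m′) ℕ.* a ℕ.+ (c ℕ.+ c′) ≡ (m ℕ.* a ℕ.+ c) ℕ.+ (m′ ℕ.* a ℕ.+ c′)
  inf-distrib = ℕ-Solver.solve-∀
  fin-distrib : ∀ i i′ k b b′ → (i ℤ.+ i′) ℤ.* k ℤ.+ (b ℤ.+ b′) ≡ (i ℤ.* k ℤ.+ b) ℤ.+ (i′ ℤ.* k ℤ.+ b′)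
  fin-distrib = solve-∀
  inf≡ : infAt (affine m c b ⊕ᵃ affine m′ c′ b′) x ≡ infAt (affine m c b) x ℕ.+ infAt (affine m′ c′ b′) x
  inf≡ = inf-distrib m m′ (infPart x) c c′
  fin≡ : finAt (affine m c b ⊕ᵃ affine m′ c′ b′) x ≡ finAt (affine m c b) x ℤ.+ finAt (affine m′ c′ b′) x
  fin≡ = trans (cong (λ i → i ℤ.* finPart x ℤ.+ (b ℤ.+ b′)) (ℤₚ.pos-+ m m′))
               (fin-distrib (+ m) (+ m′) (finPart x) b b′)

Eventually : (D → Set) → Set
Eventually A = ∃ λ M → ∀ x → M ℕ.≤ ∣ finPart x ∣ → A x

everywhere : ∀ {A : D → Set} → (∀ x → A x) → Eventually A
everywhere p = 0 , λ x _ → p x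

eventually-× : ∀ {A B : D → Set} → Eventually A → Eventually B → Eventually (λ x → A x × B x)
eventually-× (M , p) (N , q) =
  M ⊔ N , λ x big → p x (ℕₚ.m⊔n≤o⇒m≤o M N big) , q x (ℕₚ.m⊔n≤o⇒n≤o M N big)

eventually-map : ∀ {A B : D → Set} → (∀ {x} → A x → B x) → Eventually A → Eventually B
eventually-map f (M , p) = M , λ x big → f (p x big)

EventuallyAffine : (D → D) → Affine → Set
EventuallyAffine f s = Eventually λ x → f x ≡ s at x × CanonicalAt s x

eventuallyAffine-map : ∀ g s t {f} →
  Eventually (λ x → CanonicalAt s x → g (s at x) ≡ t at x × CanonicalAt t x) →
  EventuallyAffine f s → EventuallyAffine (g ∘ f) t
eventuallyAffine-map g s t G F = eventually-map
  (λ (g-at , fx≡ , can) → let (e , can′) = g-at can in trans (cong g fx≡) e , can′)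
  (eventually-× G F)

eventuallyAffine-+ᴰ : ∀ {f g} s t → EventuallyAffine f s → EventuallyAffine g t →
                      EventuallyAffine (λ x → f x +ᴰ g x) (s ⊕ᵃ t)
eventuallyAffine-+ᴰ s t F G = eventually-map
  (λ { {x} ((fx≡ , cs) , (gx≡ , ct)) →
       let (e , can) = ⊕ᵃ-at s t x cs ct in trans (cong₂ _+ᴰ_ fx≡ gx≡) e , can })
  (eventually-× F G)

affineOf : Term (suc k) → Env k → Affine
affineOf (var zero) ρ = idᵃ
affineOf (var (suc i)) ρ = constᵃ (ρ i)
affineOf zer ρ = constᵃ (std 0)
affineOf (S t) ρ = sucᵃ (affineOf t ρ)
affineOf (P t) ρ = predᵃ (affineOf t ρ)
affineOf (t ⊕ u) ρ = affineOf t ρ ⊕ᵃ affineOf u ρ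

eventuallyAffine-⟦⟧ : ∀ (t : Term (suc k)) ρ → EventuallyAffine (λ x → ⟦ t ⟧t (x ∷ₑ ρ)) (affineOf t ρ)
eventuallyAffine-⟦⟧ (var zero) ρ = everywhere idᵃ-at
eventuallyAffine-⟦⟧ (var (suc i)) ρ = everywhere (constᵃ-at (ρ i))
eventuallyAffine-⟦⟧ zer ρ = everywhere (constᵃ-at (std 0))
eventuallyAffine-⟦⟧ (S t) ρ =
  eventuallyAffine-map sucᴰ (affineOf t ρ) (sucᵃ (affineOf t ρ)) (everywhere (sucᵃ-at (affineOf t ρ))) (eventuallyAffine-⟦⟧ t ρ)
eventuallyAffine-⟦⟧ (P t) ρ =
  eventuallyAffine-map predᴰ (affineOf t ρ) (predᵃ (affineOf t ρ)) (_ , predᵃ-at (affineOf t ρ)) (eventuallyAffine-⟦⟧ t ρ)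
eventuallyAffine-⟦⟧ (t ⊕ u) ρ =
  eventuallyAffine-+ᴰ (affineOf t ρ) (affineOf u ρ) (eventuallyAffine-⟦⟧ t ρ) (eventuallyAffine-⟦⟧ u ρ)

affine-ℤ-injective : ∀ m m′ k b b′ → suc ∣ b ℤ.- b′ ∣ ℕ.≤ ∣ k ∣ →
                     + m ℤ.* k ℤ.+ b ≡ + m′ ℤ.* k ℤ.+ b′ → m ≡ m′ × b ≡ b′
affine-ℤ-injective m m′ k b b′ big e with m ℕ.≟ m′
... | yes refl = refl , +-cancelˡ-ℤ (+ m ℤ.* k) b b′ e
... | no m≢m′ = ⊥-elim (ℕₚ.<⇒≱ big ∣k∣≤∣b-b′∣)
  where
  gap : ℤ
  gap = + m ℤ.- + m′
  expand : ∀ i i′ k b → (i ℤ.- i′) ℤ.* k ≡ (i ℤ.* k ℤ.+ b) ℤ.- (i′ ℤ.* k ℤ.+ b)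
  expand = solve-∀
  collapse : ∀ i k b b′ → (i ℤ.* k ℤ.+ b′) ℤ.- (i ℤ.* k ℤ.+ b) ≡ b′ ℤ.- b
  collapse = solve-∀
  gap*k≡ : gap ℤ.* k ≡ b′ ℤ.- b
  gap*k≡ = begin
    gap ℤ.* k                                           ≡⟨ expand (+ m) (+ m′) k b ⟩
    (+ m ℤ.* k ℤ.+ b) ℤ.- (+ m′ ℤ.* k ℤ.+ b)             ≡⟨ cong (ℤ._- (+ m′ ℤ.* k ℤ.+ b)) e ⟩
    (+ m′ ℤ.* k ℤ.+ b′) ℤ.- (+ m′ ℤ.* k ℤ.+ b)           ≡⟨ collapse (+ m′) k b b′ ⟩
    b′ ℤ.- b                                            ∎
    where open ≡-Reasoning
  ∣gap∣≢0 : ∣ gap ∣ ≢ 0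
  ∣gap∣≢0 = m≢m′ ∘ ℤₚ.+-injective ∘ ℤₚ.i-j≡0⇒i≡j (+ m) (+ m′) ∘ ℤₚ.∣i∣≡0⇒i≡0
  ∣k∣≤∣b-b′∣ : ∣ k ∣ ℕ.≤ ∣ b ℤ.- b′ ∣
  ∣k∣≤∣b-b′∣ = begin
    ∣ k ∣                 ≤⟨ ℕₚ.m≤n*m ∣ k ∣ ∣ gap ∣ {{ℕ.≢-nonZero ∣gap∣≢0}} ⟩
    ∣ gap ∣ ℕ.* ∣ k ∣     ≡⟨ ℤₚ.abs-* gap k ⟨
    ∣ gap ℤ.* k ∣         ≡⟨ cong ∣_∣ gap*k≡ ⟩
    ∣ b′ ℤ.- b ∣          ≡⟨ ℤₚ.∣i-j∣≡∣j-i∣ b′ b ⟩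
    ∣ b ℤ.- b′ ∣          ∎
    where open ℕₚ.≤-Reasoning

at-injective : ∀ s t {x} → CanonicalAt s x → CanonicalAt t x →
               suc ∣ finConst s ℤ.- finConst t ∣ ℕ.≤ ∣ finPart x ∣ → s at x ≡ t at x → s ≡ t
at-injective (affine m c b) (affine m′ c′ b′) {x} cs ct big e
  with fromParts-injective cs ct e
... | inf≡ , fin≡ with affine-ℤ-injective m m′ (finPart x) b b′ big fin≡
... | refl , refl = cong (λ c → affine m c b) (ℕₚ.+-cancelˡ-≡ (m ℕ.* infPart x) c c′ inf≡)

EventuallyConstant : (D → Set) → Set₁
EventuallyConstant A = Σ Set λ L → Eventually λ x → A x ⇔ L

eventuallyConstant-≡ : ∀ {f g} s t → EventuallyAffine f s → EventuallyAffine g t →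
                       EventuallyConstant (λ x → f x ≡ g x)
eventuallyConstant-≡ s t F G = (s ≡ t) , eventually-map
  (λ ((fx≡ , cs) , (gx≡ , ct) , big) →
     mk⇔ (λ fx≡gx → at-injective s t cs ct big (trans (sym fx≡) (trans fx≡gx gx≡)))
         (λ { refl → trans fx≡ (sym gx≡) }))
  (eventually-× F (eventually-× G (suc ∣ finConst s ℤ.- finConst t ∣ , λ _ big → big)))

2*triangle : ∀ n → 2 ℕ.* triangle n ≡ n ℕ.* suc n
2*triangle zero = refl
2*triangle (suc n) = begin
  2 ℕ.* (suc n ℕ.+ triangle n)          ≡⟨ ℕₚ.*-distribˡ-+ 2 (suc n) (triangle n) ⟩
  2 ℕ.* suc n ℕ.+ 2 ℕ.* triangle n      ≡⟨ cong (2 ℕ.* suc n ℕ.+_) (2*triangle n) ⟩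
  2 ℕ.* suc n ℕ.+ n ℕ.* suc n           ≡⟨ regroup n ⟩
  suc n ℕ.* suc (suc n)                 ∎
  where
  open ≡-Reasoning
  regroup : ∀ n → 2 ℕ.* (1 ℕ.+ n) ℕ.+ n ℕ.* (1 ℕ.+ n) ≡ (1 ℕ.+ n) ℕ.* (2 ℕ.+ n)
  regroup = ℕ-Solver.solve-∀

linear<triangle : ∀ c K v → 2 ℕ.* (c ℕ.+ K ℕ.+ 1) ℕ.≤ v → c ℕ.* v ℕ.+ K ℕ.< triangle v
linear<triangle c K v big = ℕₚ.*-cancelˡ-< 2 _ _ (begin-strict
  2 ℕ.* (c ℕ.* v ℕ.+ K)                 <⟨ ℕₚ.*-monoʳ-< 2 (subst (c ℕ.* v ℕ.+ K ℕ.<_) (sym (expand c K v))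
                                                                (ℕₚ.m≤m+n _ _)) ⟩
  2 ℕ.* ((c ℕ.+ K ℕ.+ 1) ℕ.* suc v)     ≡⟨ ℕₚ.*-assoc 2 (c ℕ.+ K ℕ.+ 1) (suc v) ⟨
  2 ℕ.* (c ℕ.+ K ℕ.+ 1) ℕ.* suc v       ≤⟨ ℕₚ.*-monoˡ-≤ (suc v) big ⟩
  v ℕ.* suc v                           ≡⟨ 2*triangle v ⟨
  2 ℕ.* triangle v                      ∎)
  where
  open ℕₚ.≤-Reasoning
  expand : ∀ c K v → (c ℕ.+ K ℕ.+ 1) ℕ.* (1 ℕ.+ v) ≡ 1 ℕ.+ (c ℕ.* v ℕ.+ K) ℕ.+ (c ℕ.+ K ℕ.* v ℕ.+ v)
  expand = ℕ-Solver.solve-∀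

∣+q+b∣-lower : ∀ q b → q ℕ.≤ ∣ + q ℤ.+ b ∣ ℕ.+ ∣ b ∣
∣+q+b∣-lower q b =
  subst (ℕ._≤ ∣ + q ℤ.+ b ∣ ℕ.+ ∣ b ∣) (cong ∣_∣ (cancel (+ q) b)) (ℤₚ.∣i-j∣≤∣i∣+∣j∣ (+ q ℤ.+ b) b)
  where
  cancel : ∀ i j → i ℤ.+ j ℤ.- j ≡ i
  cancel = solve-∀

finAt-std-lower : ∀ m c b n → n ℕ.≤ ∣ finAt (affine (suc m) c b) (std n) ∣ ℕ.+ ∣ b ∣
finAt-std-lower m c b n = begin
  n                                                   ≤⟨ ℕₚ.m≤n*m n (suc m) ⟩
  suc m ℕ.* n                                         ≤⟨ ∣+q+b∣-lower (suc m ℕ.* n) b ⟩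
  ∣ + (suc m ℕ.* n) ℤ.+ b ∣ ℕ.+ ∣ b ∣                 ≡⟨ cong (λ i → ∣ i ℤ.+ b ∣ ℕ.+ ∣ b ∣) (ℤₚ.pos-* (suc m) n) ⟩
  ∣ finAt (affine (suc m) c b) (std n) ∣ ℕ.+ ∣ b ∣    ∎
  where open ℕₚ.≤-Reasoning

finAt-std-upper : ∀ m c b n → ∣ finAt (affine m c b) (std n) ∣ ℕ.≤ m ℕ.* n ℕ.+ ∣ b ∣
finAt-std-upper m c b n =
  subst (λ i → ∣ i ℤ.+ b ∣ ℕ.≤ m ℕ.* n ℕ.+ ∣ b ∣) (ℤₚ.pos-* m n) (ℤₚ.∣i+j∣≤∣i∣+∣j∣ (+ (m ℕ.* n)) b)

¬at-▷ᴰ-right : ∀ m c b c′ b′ x → suc (triangle ∣ b ∣ ℕ.+ ∣ b′ ∣) ℕ.≤ ∣ finPart x ∣ →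
               ¬ (affine 0 c b at x ▷ᴰ affine (suc m) c′ b′ at x)
¬at-▷ᴰ-right m c b c′ b′ x big r
  with ▷ᴰ-fromParts (subst (_▷ᴰ affine (suc m) c′ b′ at x) (at-slope0 c b x) r)
¬at-▷ᴰ-right m c b c′ b′ (std n) big r | _ , _ , ∣fin∣≡ = ℕₚ.<⇒≱ big (begin
  n                                                       ≤⟨ finAt-std-lower m c′ b′ n ⟩
  ∣ finAt (affine (suc m) c′ b′) (std n) ∣ ℕ.+ ∣ b′ ∣      ≡⟨ cong (ℕ._+ ∣ b′ ∣) ∣fin∣≡ ⟩
  triangle ∣ b ∣ ℕ.+ ∣ b′ ∣                               ∎)
  where open ℕₚ.≤-Reasoning
¬at-▷ᴰ-right m c b c′ b′ (nonstd a z) big r | _ , () , _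

¬at-▷ᴰ-left : ∀ m c b m′ c′ b′ x →
              ∣ b ∣ ℕ.+ 2 ℕ.* (m′ ℕ.+ (m′ ℕ.* ∣ b ∣ ℕ.+ ∣ b′ ∣) ℕ.+ 1) ℕ.≤ ∣ finPart x ∣ →
              ¬ (affine (suc m) c b at x ▷ᴰ affine m′ c′ b′ at x)
¬at-▷ᴰ-left m c b m′ c′ b′ (nonstd a z) big ()
¬at-▷ᴰ-left m c b m′ c′ b′ (std n) big r = ℕₚ.<⇒≱ (linear<triangle m′ K v v-big) Tv≤m′v+K
  where
  K v : ℕ
  K = m′ ℕ.* ∣ b ∣ ℕ.+ ∣ b′ ∣
  v = ∣ finAt (affine (suc m) c b) (std n) ∣
  n≤v+∣b∣ : n ℕ.≤ v ℕ.+ ∣ b ∣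
  n≤v+∣b∣ = finAt-std-lower m c b n
  v-big : 2 ℕ.* (m′ ℕ.+ K ℕ.+ 1) ℕ.≤ v
  v-big = ℕₚ.+-cancelˡ-≤ ∣ b ∣ _ _
            (ℕₚ.≤-trans big (ℕₚ.≤-trans n≤v+∣b∣ (ℕₚ.≤-reflexive (ℕₚ.+-comm v ∣ b ∣))))
  regroup : ∀ m′ v B B′ → m′ ℕ.* (v ℕ.+ B) ℕ.+ B′ ≡ m′ ℕ.* v ℕ.+ (m′ ℕ.* B ℕ.+ B′)
  regroup = ℕ-Solver.solve-∀
  Tv≤m′v+K : triangle v ℕ.≤ m′ ℕ.* v ℕ.+ K
  Tv≤m′v+K = begin
    triangle v                                ≡⟨ proj₂ (proj₂ (▷ᴰ-fromParts r)) ⟨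
    ∣ finAt (affine m′ c′ b′) (std n) ∣       ≤⟨ finAt-std-upper m′ c′ b′ n ⟩
    m′ ℕ.* n ℕ.+ ∣ b′ ∣                       ≤⟨ ℕₚ.+-monoˡ-≤ ∣ b′ ∣ (ℕₚ.*-monoʳ-≤ m′ n≤v+∣b∣) ⟩
    m′ ℕ.* (v ℕ.+ ∣ b ∣) ℕ.+ ∣ b′ ∣           ≡⟨ regroup m′ v ∣ b ∣ ∣ b′ ∣ ⟩
    m′ ℕ.* v ℕ.+ K                            ∎
    where open ℕₚ.≤-Reasoning

▷ᴰ-cong : ∀ {d d′ e e′} → d ≡ d′ → e ≡ e′ → (d ▷ᴰ e) ⇔ (d′ ▷ᴰ e′)
▷ᴰ-cong refl refl = ⇔-id _

eventuallyConstant-at-▷ᴰ : ∀ s t → EventuallyConstant (λ x → s at x ▷ᴰ t at x)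
eventuallyConstant-at-▷ᴰ (affine zero c b) (affine zero c′ b′) =
  (fromParts c b ▷ᴰ fromParts c′ b′) , everywhere λ x → ▷ᴰ-cong (at-slope0 c b x) (at-slope0 c′ b′ x)
eventuallyConstant-at-▷ᴰ (affine zero c b) (affine (suc m) c′ b′) =
  ⊥ , eventually-map (λ ¬r → mk⇔ ¬r ⊥-elim) (_ , ¬at-▷ᴰ-right m c b c′ b′)
eventuallyConstant-at-▷ᴰ (affine (suc m) c b) (affine m′ c′ b′) =
  ⊥ , eventually-map (λ ¬r → mk⇔ ¬r ⊥-elim) (_ , ¬at-▷ᴰ-left m c b m′ c′ b′)

eventuallyConstant-resp : ∀ {A B : D → Set} → Eventually (λ x → A x ⇔ B x) →
                          EventuallyConstant B → EventuallyConstant A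
eventuallyConstant-resp A⇔B (L , B⇔L) =
  L , eventually-map (λ (a⇔b , b⇔l) → b⇔l ⇔-∘ a⇔b) (eventually-× A⇔B B⇔L)

eventuallyConstant-▷ᴰ : ∀ {f g} s t → EventuallyAffine f s → EventuallyAffine g t →
                        EventuallyConstant (λ x → f x ▷ᴰ g x)
eventuallyConstant-▷ᴰ s t F G = eventuallyConstant-resp
  (eventually-map (λ ((fx≡ , _) , (gx≡ , _)) → ▷ᴰ-cong fx≡ gx≡) (eventually-× F G))
  (eventuallyConstant-at-▷ᴰ s t)

eventuallyConstant-¬¬ : ∀ {A : D → Set} → EventuallyConstant A → EventuallyConstant (λ x → ¬ ¬ A x)
eventuallyConstant-¬¬ (L , A⇔L) = (¬ ¬ L) , eventually-map (¬-cong-⇔ ∘ ¬-cong-⇔) A⇔L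

eventuallyConstant-→ : ∀ {A B : D → Set} → EventuallyConstant A → EventuallyConstant B →
                       EventuallyConstant (λ x → A x → B x)
eventuallyConstant-→ (L , A⇔L) (L′ , B⇔L′) =
  (L → L′) , eventually-map (uncurry →-cong-⇔) (eventually-× A⇔L B⇔L′)

eventuallyConstant-⟦⟧ : ∀ (ψ : Formula (suc k)) → QF ψ → ∀ ρ →
                        EventuallyConstant (λ x → ⟦ ψ ⟧ (x ∷ₑ ρ))
eventuallyConstant-⟦⟧ ⊥' qf⊥ ρ = ⊥ , everywhere λ _ → ⇔-id ⊥
eventuallyConstant-⟦⟧ (t ≐ u) qf≐ ρ = eventuallyConstant-¬¬
  (eventuallyConstant-≡ (affineOf t ρ) (affineOf u ρ) (eventuallyAffine-⟦⟧ t ρ) (eventuallyAffine-⟦⟧ u ρ))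
eventuallyConstant-⟦⟧ (t ▷ u) qf▷ ρ = eventuallyConstant-¬¬
  (eventuallyConstant-▷ᴰ (affineOf t ρ) (affineOf u ρ) (eventuallyAffine-⟦⟧ t ρ) (eventuallyAffine-⟦⟧ u ρ))
eventuallyConstant-⟦⟧ (φ ⇒ ψ) (qf⇒ qφ qψ) ρ =
  eventuallyConstant-→ (eventuallyConstant-⟦⟧ φ qφ ρ) (eventuallyConstant-⟦⟧ ψ qψ ρ)

induction-from-far : ∀ {A : ℤ → Set} M → (∀ z → M ℕ.≤ ∣ z ∣ → A z) → (∀ z → A z → A (ℤ.suc z)) → ∀ z → A z
induction-from-far {A} M far step z = subst A (cancel z (+ W)) (climb W)
  where
  W : ℕ
  W = M ℕ.+ ∣ z ∣
  z₀ : ℤ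
  z₀ = z ℤ.- + W
  cancel : ∀ i j → i ℤ.- j ℤ.+ j ≡ i
  cancel = solve-∀
  unshift : ∀ i j → j ≡ i ℤ.- (i ℤ.- j)
  unshift = solve-∀
  z₀-far : M ℕ.≤ ∣ z₀ ∣
  z₀-far = ℕₚ.+-cancelˡ-≤ ∣ z ∣ _ _ (begin
    ∣ z ∣ ℕ.+ M          ≡⟨ ℕₚ.+-comm ∣ z ∣ M ⟩
    ∣ + W ∣              ≡⟨ cong ∣_∣ (unshift z (+ W)) ⟩
    ∣ z ℤ.- z₀ ∣         ≤⟨ ℤₚ.∣i-j∣≤∣i∣+∣j∣ z z₀ ⟩
    ∣ z ∣ ℕ.+ ∣ z₀ ∣     ∎)
    where open ℕₚ.≤-Reasoning
  climb : ∀ w → A (z₀ ℤ.+ + w)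
  climb zero = subst A (sym (ℤₚ.+-identityʳ z₀)) (far z₀ z₀-far)
  climb (suc w) = subst A (sym (+-sucʳ z₀ (+ w))) (step _ (climb w))

eventuallyConstant-induction : ∀ {A : D → Set} → EventuallyConstant A →
                               A (std 0) → (∀ d → A d → A (sucᴰ d)) → ∀ d → A d
eventuallyConstant-induction {A} (L , M , A⇔L) base step = go
  where
  standard : ∀ n → A (std n)
  standard zero = base
  standard (suc n) = step (std n) (standard n)
  l : L
  l = to (A⇔L (std M) ℕₚ.≤-refl) (standard M)
  go : ∀ d → A d
  go (std n) = standard n
  go (nonstd a z) =
    induction-from-far M (λ z far → from (A⇔L (nonstd a z) far) l) (λ z → step (nonstd a z)) z

⊨T▷+IOpen : Models T▷+IOpen
⊨T▷+IOpen A1 d ¬¬sd≡0 = ¬¬sd≡0 (sucᴰ≢std0 d)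
⊨T▷+IOpen A2 ¬eq = ¬eq refl
⊨T▷+IOpen A3 d ¬eq = ¬eq (predᴰ-sucᴰ d)
⊨T▷+IOpen A4 d ¬eq = ¬eq (+ᴰ-identityʳ d)
⊨T▷+IOpen A5 d e ¬eq = ¬eq (+ᴰ-suc d e)
⊨T▷+IOpen A6 ¬r = ¬r refl
⊨T▷+IOpen A7 d e = ¬¬-map (▷ᴰ-step d e)
⊨T▷+IOpen A8 d e = ¬¬-map (▷ᴰ-unstep d e)
⊨T▷+IOpen A9 d e e′ both ¬eq = both λ ¬¬r ¬¬r′ → ¬¬r λ r → ¬¬r′ λ r′ → ¬eq (▷ᴰ-functional d e e′ r r′)
⊨T▷+IOpen (IOpen ψ qf) = ⟦close⟧ _ λ ρ base step →
  eventuallyConstant-induction (eventuallyConstant-⟦⟧ ψ qf ρ)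
    (to (⟦inst⟧ ψ zer ρ) base) (λ d → to (⟦succX⟧ ψ d ρ) ∘ step d)

proposition4p4 : ¬ (T▷+IOpen ⊢ ∀' (∃' (var (suc zero) ▷ var zero)))
proposition4p4 ⊢∀∃ = soundness ⊨T▷+IOpen ⊢∀∃ ∅ [] ω no-triangle
  where
  ω : D
  ω = nonstd 0 0ℤ
  no-triangle : ∀ y → ¬ ¬ (ω ▷ᴰ y) → ⊥
  no-triangle y ¬¬r = ¬¬r λ ()
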